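{- Let $n\ge0$ be an integer and $\theta=\frac{1}{\sqrt5}\phi^{ -1}$. (1) There exists $1\le\ell\le5$ with $\delta_{n+\ell}<\theta$, and one can choose $\ell\le3$ unless $\delta_n\in[0,.15)\cup(.65,.77)$. Moreover, there exist $1\le\ell<\ell'\le6$ with $\delta_{n+\ell},\delta_{n+\ell'}<\theta$ unless $\delta_n\in[0,.3)\cup(.65,1]$. (2) There exists $1\le\ell\le5$ with $\Delta_{n+\ell}<\theta$, and one can choose $\ell\le3$ unless $\Delta_n\in(.13,.24)\cup(.51,.62)$. Moreover, there exist $1\le\ell<\ell'\le6$ with $\Delta_{n+\ell},\Delta_{n+\ell'}<\theta$ unless $\Delta_n\in[0,.24)\cup(.36,.62)\cup(.97,1]$.
   Context: $\phi=(1+\sqrt5)/2$, $\delta_n=\phi n-\lfloor\phi n\rfloor$, $\Delta_n=\lceil\phi n\rceil-\phi n$. -}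

module Defs where

-- Exact arithmetic in the real quadratic field ℚ(√5) ⊂ ℝ.
-- All quantities in the statement (φ, θ, φn, δ_n, Δ_n, the decimal bounds)
-- lie in ℚ(√5), so the real order restricted to ℚ(√5) suffices.

open import Data.Nat as ℕ using (ℕ; zero; suc)
open import Data.Integer as ℤ using (ℤ; +_)
open import Data.Rational.Unnormalised as Q using (ℚᵘ; 0ℚᵘ)
open import Data.Rational.Unnormalised.Properties as QP using ()
open import Data.Product using (_×_; _,_)
open import Data.Sum using (_⊎_)
open import Data.Bool using (Bool; true; false)
open import Relation.Nullary using (¬_; Dec; does)
open import Relation.Nullary.Decidable using (_×-dec_; _⊎-dec_; ¬?)

record Q5 : Set where
  constructor _+√5·_
  field
    re : ℚᵘ
    im : ℚᵘ
open Q5 public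

infixl 6 _+₅_ _-₅_
infix 4 _<₅_ _≤₅_

_+₅_ : Q5 → Q5 → Q5
(a +√5· b) +₅ (c +√5· d) = (a Q.+ c) +√5· (b Q.+ d)

_-₅_ : Q5 → Q5 → Q5
(a +√5· b) -₅ (c +√5· d) = (a Q.- c) +√5· (b Q.- d)

ofℚ : ℚᵘ → Q5
ofℚ q = q +√5· 0ℚᵘ

ofℕ : ℕ → Q5
ofℕ n = ofℚ ((+ n) Q./ 1)

pct : ℕ → Q5
pct p = ofℚ ((+ p) Q./ 100)

-- a + b√5 > 0 (case analysis on signs; √5 > 0 and (b√5)² = 5b²)
Pos : Q5 → Set
Pos (a +√5· b) =
    (0ℚᵘ Q.≤ a × 0ℚᵘ Q.≤ b × (0ℚᵘ Q.< a ⊎ 0ℚᵘ Q.< b))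
  ⊎ (0ℚᵘ Q.< a × b Q.< 0ℚᵘ × five Q.* (b Q.* b) Q.< a Q.* a)
  ⊎ (a Q.< 0ℚᵘ × 0ℚᵘ Q.< b × a Q.* a Q.< five Q.* (b Q.* b))
  where
  five : ℚᵘ
  five = (+ 5) Q./ 1

Pos? : (x : Q5) → Dec (Pos x)
Pos? (a +√5· b) =
      ((0ℚᵘ QP.≤? a) ×-dec ((0ℚᵘ QP.≤? b) ×-dec ((0ℚᵘ QP.<? a) ⊎-dec (0ℚᵘ QP.<? b))))
  ⊎-dec ((0ℚᵘ QP.<? a) ×-dec ((b QP.<? 0ℚᵘ) ×-dec (five Q.* (b Q.* b) QP.<? a Q.* a)))
  ⊎-dec ((a QP.<? 0ℚᵘ) ×-dec ((0ℚᵘ QP.<? b) ×-dec (a Q.* a QP.<? five Q.* (b Q.* b))))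
  where
  five : ℚᵘ
  five = (+ 5) Q./ 1

_<₅_ : Q5 → Q5 → Set
x <₅ y = Pos (y -₅ x)

_≤₅_ : Q5 → Q5 → Set
x ≤₅ y = ¬ (y <₅ x)

-- φ = (1 + √5)/2 ;  φ·n = n/2 + (n/2)√5
φ· : ℕ → Q5
φ· n = ((+ n) Q./ 2) +√5· ((+ n) Q./ 2)

-- θ = 1/(√5 φ) = 2/(5 + √5) = (5 - √5)/10 = 1/2 - (1/10)√5
θ : Q5
θ = ((+ 1) Q./ 2) +√5· (ℤ.- (+ 1) Q./ 10)

-- ⌊φn⌋ = #{ k ∈ {1,…,2n} : k ≤ φn }   (valid since 0 ≤ φn < 2n+1)
-- ⌈φn⌉ = #{ k ∈ {0,…,2n} : k < φn }
private
  bit : Bool → ℕ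
  bit true  = 1
  bit false = 0

  countLe : ℕ → ℕ → ℕ
  countLe n zero    = 0
  countLe n (suc m) = bit (does (¬? (Pos? (ofℕ (suc m) -₅ φ· n)))) ℕ.+ countLe n m

  countLt : ℕ → ℕ → ℕ
  countLt n zero    = 0
  countLt n (suc m) = bit (does (Pos? (φ· n -₅ ofℕ m))) ℕ.+ countLt n m

⌊φ·_⌋ : ℕ → ℕ
⌊φ· n ⌋ = countLe n (2 ℕ.* n)

⌈φ·_⌉ : ℕ → ℕ
⌈φ· n ⌉ = countLt n (suc (2 ℕ.* n))

δ : ℕ → Q5
δ n = φ· n -₅ ofℕ ⌊φ· n ⌋

Δ : ℕ → Q5
Δ n = ofℕ ⌈φ· n ⌉ -₅ φ· n

Ico : ℕ → ℕ → Q5 → Set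
Ico p q x = pct p ≤₅ x × x <₅ pct q

Ioo : ℕ → ℕ → Q5 → Set
Ioo p q x = pct p <₅ x × x <₅ pct q

Ioc : ℕ → ℕ → Q5 → Set
Ioc p q x = pct p <₅ x × x ≤₅ pct q

{-# OPTIONS --safe #-}
-- δ_{n+ℓ} is the fractional part of δ_n + ℓφ (and Δ_{n+ℓ} that of Δ_n − ℓφ), so whether it lies
-- below θ depends only on δ_n (resp. Δ_n) ∈ [0, 1). Each claim is proved by cutting [0, 1) at a few
-- points of ℚ(√5) and exhibiting, for every piece, a step ℓ and the integer part of δ_n + ℓφ that
-- are the same on the whole piece. The comparisons are exact: a + b√5 > 0 is decided by signs and
-- by the norm a² − 5b², and its compatibility with addition follows from the fact that a + b√5 > 0
-- exactly when the affine map t ↦ a + bt is positive at one rational below √5 and one above it;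
-- trichotomy rests on the irrationality of √5.
module Submission where

open import Defs

module QuadraticIntegers where
  open import Data.Empty using (⊥-elim)
  open import Data.Integer as ℤ using (ℤ; +_; 0ℤ; _+_; _-_; -_; _*_; _<_; _≤_)
  import Data.Integer.Properties as ℤₚ
  open import Data.Integer.Tactic.RingSolver using (solve-∀)
  open import Data.Nat as ℕ using (ℕ)
  open import Data.Nat.Divisibility using (_∣_; divides)
  open import Data.Nat.Induction using (<-wellFounded)
  open import Data.Nat.Primality using (prime?; euclidsLemma)
  import Data.Nat.Properties as ℕₚ
  open import Data.Nat.Tactic.RingSolver using () renaming (solve-∀ to ℕ-solve-∀)
  open import Data.Product using (_×_; _,_; proj₁; proj₂; Σ-syntax)
  open import Data.Sum using (_⊎_; inj₁; inj₂; [_,_]; reduce)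
  open import Induction.WellFounded using (Acc; acc)
  open import Relation.Binary.Definitions using (tri<; tri≈; tri>)
  open import Relation.Binary.PropositionalEquality
    using (_≡_; refl; sym; trans; cong; cong₂; subst; subst₂; module ≡-Reasoning)
  open import Relation.Nullary using (¬_; Dec; yes; no; ¬?)
  open import Relation.Nullary.Decidable using (from-yes; map′; _×-dec_; _⊎-dec_)

  private variable
    a b : ℤ

  *-pos : 0ℤ < a → 0ℤ < b → 0ℤ < a * b
  *-pos {a} {b} 0<a 0<b = subst (_< a * b) (ℤₚ.*-zeroʳ a) (ℤₚ.*-monoˡ-<-pos a {{ℤ.positive 0<a}} 0<b)

  *-nonNeg : 0ℤ ≤ a → 0ℤ ≤ b → 0ℤ ≤ a * b
  *-nonNeg {a} {b} 0≤a 0≤b = subst (_≤ a * b) (ℤₚ.*-zeroʳ a) (ℤₚ.*-monoˡ-≤-nonNeg a {{ℤ.nonNegative 0≤a}} 0≤b)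

  *-pos-cancelˡ : 0ℤ < a → 0ℤ < a * b → 0ℤ < b
  *-pos-cancelˡ {a} {b} 0<a 0<ab =
    ℤₚ.*-cancelˡ-<-nonNeg a {{ℤ.nonNegative (ℤₚ.<⇒≤ 0<a)}} (subst (_< a * b) (sym (ℤₚ.*-zeroʳ a)) 0<ab)

  0<+ : 0ℤ < a → 0ℤ ≤ b → 0ℤ < a + b
  0<+ = ℤₚ.+-mono-<-≤

  +0< : 0ℤ ≤ a → 0ℤ < b → 0ℤ < a + b
  +0< = ℤₚ.+-mono-≤-<

  0<-by : 0ℤ < a → a ≡ b → 0ℤ < b
  0<-by 0<a refl = 0<a

  0≤-by : 0ℤ ≤ a → a ≡ b → 0ℤ ≤ b
  0≤-by 0≤a refl = 0≤a

  <⇒0<- : a < b → 0ℤ < b - a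
  <⇒0<- {a} {b} a<b = subst (_< b - a) (ℤₚ.+-inverseʳ a) (ℤₚ.+-monoˡ-< (- a) a<b)

  0<-⇒< : 0ℤ < b - a → a < b
  0<-⇒< {b} {a} 0<b-a = subst₂ _<_ (ℤₚ.+-identityˡ a) (cancel b a) (ℤₚ.+-monoˡ-< a 0<b-a)
    where
    cancel : ∀ b a → b - a + a ≡ b
    cancel = solve-∀

  neg-pos : a < 0ℤ → 0ℤ < - a
  neg-pos = ℤₚ.neg-mono-<

  neg² : ∀ a → - a * - a ≡ a * a
  neg² = solve-∀

  square-nonNeg : ∀ a → 0ℤ ≤ a * a
  square-nonNeg a with ℤₚ.<-cmp a 0ℤ
  ... | tri< a<0 _ _ = subst (0ℤ ≤_) (neg² a) (ℤₚ.<⇒≤ (*-pos (neg-pos a<0) (neg-pos a<0)))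
  ... | tri≈ _ refl _ = ℤₚ.≤-refl
  ... | tri> _ _ 0<a = ℤₚ.<⇒≤ (*-pos 0<a 0<a)

  square-reflects-< : 0ℤ ≤ b → a * a < b * b → a < b
  square-reflects-< {b} {a} 0≤b a²<b² with a ℤₚ.<? b
  ... | yes a<b = a<b
  ... | no a≮b = ⊥-elim (ℤₚ.<⇒≱ a²<b² (ℤₚ.≤-trans (ℤₚ.*-monoˡ-≤-nonNeg b {{ℤ.nonNegative 0≤b}} b≤a)
                                                   (ℤₚ.*-monoʳ-≤-nonNeg a {{ℤ.nonNegative (ℤₚ.≤-trans 0≤b b≤a)}} b≤a)))
    where
    b≤a : b ≤ a
    b≤a = ℤₚ.≮⇒≥ a≮b

  5∣square⇒5∣ : ∀ m → 5 ∣ m ℕ.* m → 5 ∣ m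
  5∣square⇒5∣ m 5∣m² = reduce (euclidsLemma m m (from-yes (prime? 5)) 5∣m²)

  square≢5*square : ∀ a b → a ℕ.* a ≡ 5 ℕ.* (b ℕ.* b) → b ≡ 0
  square≢5*square a b = descent b (<-wellFounded b) a
    where
    5∣-root : ∀ m n → m ℕ.* m ≡ 5 ℕ.* n → 5 ∣ m
    5∣-root m n eq = 5∣square⇒5∣ m (divides n (trans eq (ℕₚ.*-comm 5 n)))
    swap : ∀ a a′ b → a ≡ a′ ℕ.* 5 → a ℕ.* a ≡ 5 ℕ.* (b ℕ.* b) → b ℕ.* b ≡ 5 ℕ.* (a′ ℕ.* a′)
    swap _ a′ _ refl eq = ℕₚ.*-cancelˡ-≡ _ _ 5 (trans (sym eq) (quintuple a′))
      where
      quintuple : ∀ x → x ℕ.* 5 ℕ.* (x ℕ.* 5) ≡ 5 ℕ.* (5 ℕ.* (x ℕ.* x))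
      quintuple = ℕ-solve-∀
    descent : ∀ b → Acc ℕ._<_ b → ∀ a → a ℕ.* a ≡ 5 ℕ.* (b ℕ.* b) → b ≡ 0
    descent ℕ.zero _ _ _ = refl
    descent b@(ℕ.suc _) (acc smaller) a a²≡5b² with 5∣-root a (b ℕ.* b) a²≡5b²
    ... | divides a′ a≡a′*5 with 5∣-root b (a′ ℕ.* a′) (swap a a′ b a≡a′*5 a²≡5b²)
    ...   | divides ℕ.zero ()
    ...   | divides b′@(ℕ.suc _) b≡b′*5 =
      trans b≡b′*5 (cong (ℕ._* 5) (descent b′ (smaller b′<b) a′ (swap b b′ a′ b≡b′*5 (swap a a′ b a≡a′*5 a²≡5b²))))
      where
      b′<b : b′ ℕ.< b
      b′<b = subst (b′ ℕ.<_) (sym b≡b′*5) (ℕₚ.m<m*n b′ 5 (ℕ.s≤s (ℕ.s≤s ℕ.z≤n)))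

  √5-irrational : ∀ a b → a * a ≡ + 5 * (b * b) → b ≡ 0ℤ
  √5-irrational a b a²≡5b² = ℤₚ.∣i∣≡0⇒i≡0 (square≢5*square ℤ.∣ a ∣ ℤ.∣ b ∣ (begin
    ℤ.∣ a ∣ ℕ.* ℤ.∣ a ∣         ≡⟨ ℤₚ.abs-* a a ⟨
    ℤ.∣ a * a ∣                 ≡⟨ cong ℤ.∣_∣ a²≡5b² ⟩
    ℤ.∣ + 5 * (b * b) ∣         ≡⟨ ℤₚ.abs-* (+ 5) (b * b) ⟩
    5 ℕ.* ℤ.∣ b * b ∣           ≡⟨ cong (5 ℕ.*_) (ℤₚ.abs-* b b) ⟩
    5 ℕ.* (ℤ.∣ b ∣ ℕ.* ℤ.∣ b ∣) ∎))
    where open ≡-Reasoning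

  infix 5 _+_√5 _-_√5
  record ℤ√5 : Set where
    constructor _+_√5
    field
      rational surd : ℤ

  _-_√5 : ℤ → ℤ → ℤ√5
  a - b √5 = a + - b √5

  infixl 6 _⊕_ _⊖_
  _⊕_ _⊖_ : ℤ√5 → ℤ√5 → ℤ√5
  (a + b √5) ⊕ (c + d √5) = (a + c) + (b + d) √5
  (a + b √5) ⊖ (c + d √5) = (a - c) + (b - d) √5

  Positive : ℤ√5 → Set
  Positive (a + b √5) =
      (0ℤ ≤ a × 0ℤ ≤ b × (0ℤ < a ⊎ 0ℤ < b))
    ⊎ (0ℤ < a × b < 0ℤ × + 5 * (b * b) < a * a)
    ⊎ (a < 0ℤ × 0ℤ < b × a * a < + 5 * (b * b))

  positive? : ∀ x → Dec (Positive x)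
  positive? (a + b √5) =
          (0ℤ ℤₚ.≤? a ×-dec 0ℤ ℤₚ.≤? b ×-dec (0ℤ ℤₚ.<? a ⊎-dec 0ℤ ℤₚ.<? b))
    ⊎-dec (0ℤ ℤₚ.<? a ×-dec b ℤₚ.<? 0ℤ ×-dec + 5 * (b * b) ℤₚ.<? a * a)
    ⊎-dec (a ℤₚ.<? 0ℤ ×-dec 0ℤ ℤₚ.<? b ×-dec a * a ℤₚ.<? + 5 * (b * b))

  nonPositive-parts : a ≤ 0ℤ → b ≤ 0ℤ → ¬ Positive (a + b √5)
  nonPositive-parts a≤0 b≤0 (inj₁ (_ , _ , inj₁ 0<a)) = ℤₚ.<⇒≱ 0<a a≤0
  nonPositive-parts a≤0 b≤0 (inj₁ (_ , _ , inj₂ 0<b)) = ℤₚ.<⇒≱ 0<b b≤0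
  nonPositive-parts a≤0 b≤0 (inj₂ (inj₁ (0<a , _))) = ℤₚ.<⇒≱ 0<a a≤0
  nonPositive-parts a≤0 b≤0 (inj₂ (inj₂ (_ , 0<b , _))) = ℤₚ.<⇒≱ 0<b b≤0

  nonPositive-norm : a ≤ 0ℤ → + 5 * (b * b) ≤ a * a → ¬ Positive (a + b √5)
  nonPositive-norm a≤0 _ (inj₁ (_ , _ , inj₁ 0<a)) = ℤₚ.<⇒≱ 0<a a≤0
  nonPositive-norm {a} {b} a≤0 5b²≤a² (inj₁ (0≤a , _ , inj₂ 0<b)) with ℤₚ.≤-antisym a≤0 0≤a
  ... | refl = ℤₚ.<⇒≱ (*-pos (ℤₚ.positive⁻¹ (+ 5)) (*-pos 0<b 0<b)) 5b²≤a²
  nonPositive-norm a≤0 _ (inj₂ (inj₁ (0<a , _))) = ℤₚ.<⇒≱ 0<a a≤0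
  nonPositive-norm _ 5b²≤a² (inj₂ (inj₂ (_ , _ , a²<5b²))) = ℤₚ.<⇒≱ a²<5b² 5b²≤a²

  positive-trichotomy : ∀ a b → Positive (a + b √5) ⊎ Positive (- a + - b √5) ⊎ (a ≡ 0ℤ × b ≡ 0ℤ)
  positive-trichotomy a b with ℤₚ.<-cmp a 0ℤ | ℤₚ.<-cmp b 0ℤ
  ... | tri> _ _ 0<a  | tri> _ _ 0<b  = inj₁ (inj₁ (ℤₚ.<⇒≤ 0<a , ℤₚ.<⇒≤ 0<b , inj₁ 0<a))
  ... | tri> _ _ 0<a  | tri≈ _ refl _ = inj₁ (inj₁ (ℤₚ.<⇒≤ 0<a , ℤₚ.≤-refl , inj₁ 0<a))
  ... | tri≈ _ refl _ | tri> _ _ 0<b  = inj₁ (inj₁ (ℤₚ.≤-refl , ℤₚ.<⇒≤ 0<b , inj₂ 0<b))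
  ... | tri≈ _ refl _ | tri≈ _ refl _ = inj₂ (inj₂ (refl , refl))
  ... | tri< a<0 _ _  | tri< b<0 _ _  =
    inj₂ (inj₁ (inj₁ (ℤₚ.<⇒≤ (neg-pos a<0) , ℤₚ.<⇒≤ (neg-pos b<0) , inj₁ (neg-pos a<0))))
  ... | tri< a<0 _ _  | tri≈ _ refl _ = inj₂ (inj₁ (inj₁ (ℤₚ.<⇒≤ (neg-pos a<0) , ℤₚ.≤-refl , inj₁ (neg-pos a<0))))
  ... | tri≈ _ refl _ | tri< b<0 _ _  = inj₂ (inj₁ (inj₁ (ℤₚ.≤-refl , ℤₚ.<⇒≤ (neg-pos b<0) , inj₂ (neg-pos b<0))))
  ... | tri> _ _ 0<a  | tri< b<0 _ _ with ℤₚ.<-cmp (+ 5 * (b * b)) (a * a)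
  ...   | tri< 5b²<a² _ _ = inj₁ (inj₂ (inj₁ (0<a , b<0 , 5b²<a²)))
  ...   | tri≈ _ 5b²≡a² _ = ⊥-elim (ℤₚ.<-irrefl (√5-irrational a b (sym 5b²≡a²)) b<0)
  ...   | tri> _ _ a²<5b² = inj₂ (inj₁ (inj₂ (inj₂ (ℤₚ.neg-mono-< 0<a , neg-pos b<0 ,
                              subst₂ _<_ (sym (neg² a)) (cong (+ 5 *_) (sym (neg² b))) a²<5b²))))
  positive-trichotomy a b | tri< a<0 _ _ | tri> _ _ 0<b with ℤₚ.<-cmp (a * a) (+ 5 * (b * b))
  ...   | tri< a²<5b² _ _ = inj₁ (inj₂ (inj₂ (a<0 , 0<b , a²<5b²)))
  ...   | tri≈ _ a²≡5b² _ = ⊥-elim (ℤₚ.<-irrefl (sym (√5-irrational a b a²≡5b²)) 0<b)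
  ...   | tri> _ _ 5b²<a² = inj₂ (inj₁ (inj₂ (inj₁ (neg-pos a<0 , ℤₚ.neg-mono-< 0<b ,
                              subst₂ _<_ (cong (+ 5 *_) (sym (neg² b))) (sym (neg² a)) 5b²<a²))))

  infix 7 _∕_
  record Fraction : Set where
    constructor _∕_
    field
      num den : ℤ
  open Fraction using (den)

  BelowRoot AboveRoot : Fraction → Set
  BelowRoot (p ∕ q) = 0ℤ ≤ p × 0ℤ < q × p * p < + 5 * (q * q)
  AboveRoot (p ∕ q) = 0ℤ ≤ p × 0ℤ < q × + 5 * (q * q) < p * p

  infix 4 _≤ᶠ_
  _≤ᶠ_ : Fraction → Fraction → Set
  (p ∕ q) ≤ᶠ (p′ ∕ q′) = p * q′ ≤ p′ * q

  -- x at t is q (a + b t) for x = a + b √5 and t = p / q: since t ↦ a + b t is affine, a + b √5 > 0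
  -- exactly when it is positive at some fraction below √5 and at some fraction above it.
  infix 8 _at_
  _at_ : ℤ√5 → Fraction → ℤ
  (a + b √5) at (p ∕ q) = a * q + b * p

  record Bracket (x : ℤ√5) : Set where
    field
      low high : Fraction
      low<√5 : BelowRoot low
      √5<high : AboveRoot high
      positive-at-low : 0ℤ < x at low
      positive-at-high : 0ℤ < x at high
  open Bracket

  two-below : BelowRoot (+ 2 ∕ + 1)
  two-below = ℤ.+≤+ ℕ.z≤n , ℤₚ.positive⁻¹ (+ 1) , from-yes (+ 2 * + 2 ℤₚ.<? + 5 * (+ 1 * + 1))

  three-above : AboveRoot (+ 3 ∕ + 1)
  three-above = ℤ.+≤+ ℕ.z≤n , ℤₚ.positive⁻¹ (+ 1) , from-yes (+ 5 * (+ 1 * + 1) ℤₚ.<? + 3 * + 3)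

  +-*-neg : ∀ x l b → x + l * - b ≡ x - l * b
  +-*-neg = solve-∀

  -- In the two mixed-sign cases the fraction beyond √5 is (3t + 5)/(t + 3) for t = |a / b|,
  -- which lies strictly between √5 and t.
  positive⇒bracket : ∀ x → Positive x → Bracket x
  positive⇒bracket (a + b √5) (inj₁ (0≤a , 0≤b , 0<a⊎0<b)) = record
    { low = + 2 ∕ + 1 ; high = + 3 ∕ + 1 ; low<√5 = two-below ; √5<high = three-above
    ; positive-at-low = at (ℤₚ.positive⁻¹ (+ 2)) ; positive-at-high = at (ℤₚ.positive⁻¹ (+ 3)) }
    where
    at : ∀ {k} → 0ℤ < k → 0ℤ < a * + 1 + b * k
    at 0<k = [ (λ 0<a → 0<+ (*-pos 0<a (ℤₚ.positive⁻¹ (+ 1))) (*-nonNeg 0≤b (ℤₚ.<⇒≤ 0<k)))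
             , (λ 0<b → +0< (*-nonNeg 0≤a (ℤₚ.<⇒≤ (ℤₚ.positive⁻¹ (+ 1)))) (*-pos 0<b 0<k)) ] 0<a⊎0<b
  positive⇒bracket (a + b √5) (inj₂ (inj₁ (0<a , b<0 , 5b²<a²))) = record
    { low = + 2 ∕ + 1 ; high = (+ 3 * a - + 5 * b) ∕ (a - + 3 * b) ; low<√5 = two-below
    ; √5<high = ℤₚ.<⇒≤ (0<x-lb (*-pos (ℤₚ.positive⁻¹ (+ 3)) 0<a) (ℤₚ.positive⁻¹ (+ 5))) ,
                0<x-lb 0<a (ℤₚ.positive⁻¹ (+ 3)) ,
                0<-⇒< (0<-by (*-pos (ℤₚ.positive⁻¹ (+ 4)) 0<norm) (gap a b))
    ; positive-at-low = *-pos-cancelˡ (0<x-lb 0<a (ℤₚ.positive⁻¹ (+ 2)))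
                                      (0<-by (0<+ 0<norm (square-nonNeg b)) (at-two a b))
    ; positive-at-high = 0<-by 0<norm (at-high a b) }
    where
    0<norm : 0ℤ < a * a - + 5 * (b * b)
    0<norm = <⇒0<- 5b²<a²
    0<x-lb : ∀ {x l} → 0ℤ < x → 0ℤ < l → 0ℤ < x - l * b
    0<x-lb {x} {l} 0<x 0<l = 0<-by (0<+ 0<x (ℤₚ.<⇒≤ (*-pos 0<l (neg-pos b<0)))) (+-*-neg x l b)
    gap : ∀ a b → + 4 * (a * a - + 5 * (b * b))
                  ≡ (+ 3 * a - + 5 * b) * (+ 3 * a - + 5 * b) - + 5 * ((a - + 3 * b) * (a - + 3 * b))
    gap = solve-∀
    at-two : ∀ a b → a * a - + 5 * (b * b) + b * b ≡ (a - + 2 * b) * (a * + 1 + b * + 2)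
    at-two = solve-∀
    at-high : ∀ a b → a * a - + 5 * (b * b) ≡ a * (a - + 3 * b) + b * (+ 3 * a - + 5 * b)
    at-high = solve-∀
  positive⇒bracket (a + b √5) (inj₂ (inj₂ (a<0 , 0<b , a²<5b²))) = record
    { low = (+ 5 * b - + 3 * a) ∕ (+ 3 * b - a) ; high = + 3 ∕ + 1
    ; low<√5 = ℤₚ.<⇒≤ (0<x-la (*-pos (ℤₚ.positive⁻¹ (+ 5)) 0<b) (ℤₚ.positive⁻¹ (+ 3))) , 0<3b-a ,
               0<-⇒< (0<-by (*-pos (ℤₚ.positive⁻¹ (+ 4)) 0<norm) (gap a b))
    ; √5<high = three-above
    ; positive-at-low = 0<-by 0<norm (at-low a b)
    ; positive-at-high = *-pos-cancelˡ 0<3b-a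
        (0<-by (0<+ 0<norm (*-nonNeg (ℤₚ.<⇒≤ (ℤₚ.positive⁻¹ (+ 4))) (square-nonNeg b))) (at-three a b)) }
    where
    0<norm : 0ℤ < + 5 * (b * b) - a * a
    0<norm = <⇒0<- a²<5b²
    0<3b-a : 0ℤ < + 3 * b - a
    0<3b-a = 0<+ (*-pos (ℤₚ.positive⁻¹ (+ 3)) 0<b) (ℤₚ.<⇒≤ (neg-pos a<0))
    0<x-la : ∀ {x l} → 0ℤ < x → 0ℤ < l → 0ℤ < x - l * a
    0<x-la {x} {l} 0<x 0<l = 0<-by (0<+ 0<x (ℤₚ.<⇒≤ (*-pos 0<l (neg-pos a<0)))) (+-*-neg x l a)
    gap : ∀ a b → + 4 * (+ 5 * (b * b) - a * a)
                  ≡ + 5 * ((+ 3 * b - a) * (+ 3 * b - a)) - (+ 5 * b - + 3 * a) * (+ 5 * b - + 3 * a)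
    gap = solve-∀
    at-low : ∀ a b → + 5 * (b * b) - a * a ≡ a * (+ 3 * b - a) + b * (+ 5 * b - + 3 * a)
    at-low = solve-∀
    at-three : ∀ a b → + 5 * (b * b) - a * a + + 4 * (b * b) ≡ (+ 3 * b - a) * (a * + 1 + b * + 3)
    at-three = solve-∀

  bracket⇒positive : ∀ x → Bracket x → Positive x
  bracket⇒positive (a + b √5) record
    { low = l₁ ∕ l₂ ; high = h₁ ∕ h₂
    ; low<√5 = _ , 0<l₂ , l₁²<5l₂² ; √5<high = 0≤h₁ , 0<h₂ , 5h₂²<h₁²
    ; positive-at-low = 0<al₂+bl₁ ; positive-at-high = 0<ah₂+bh₁ }
    with ℤₚ.<-cmp b 0ℤ
  ... | tri< b<0 _ _ = inj₂ (inj₁ (0<a , b<0 , 0<-⇒< (*-pos-cancelˡ (*-pos 0<h₂ 0<h₂) (0<-by sum (norm a b h₁ h₂)))))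
    where
    0≤-bh₁ : 0ℤ ≤ - b * h₁
    0≤-bh₁ = *-nonNeg (ℤₚ.<⇒≤ (neg-pos b<0)) 0≤h₁
    0<a : 0ℤ < a
    0<a = *-pos-cancelˡ 0<h₂ (0<-by (0<+ 0<ah₂+bh₁ 0≤-bh₁) (unshift a b h₁ h₂))
      where
      unshift : ∀ a b h₁ h₂ → a * h₂ + b * h₁ + - b * h₁ ≡ h₂ * a
      unshift = solve-∀
    sum : 0ℤ < (a * h₂ + b * h₁) * (a * h₂ + b * h₁ + + 2 * (- b * h₁)) + b * b * (h₁ * h₁ - + 5 * (h₂ * h₂))
    sum = 0<+ (*-pos 0<ah₂+bh₁ (0<+ 0<ah₂+bh₁ (*-nonNeg (ℤₚ.<⇒≤ (ℤₚ.positive⁻¹ (+ 2))) 0≤-bh₁)))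
              (*-nonNeg (square-nonNeg b) (ℤₚ.<⇒≤ (<⇒0<- 5h₂²<h₁²)))
    norm : ∀ a b h₁ h₂ → (a * h₂ + b * h₁) * (a * h₂ + b * h₁ + + 2 * (- b * h₁)) + b * b * (h₁ * h₁ - + 5 * (h₂ * h₂))
                         ≡ h₂ * h₂ * (a * a - + 5 * (b * b))
    norm = solve-∀
  ... | tri≈ _ refl _ = inj₁ (ℤₚ.<⇒≤ 0<a , ℤₚ.≤-refl , inj₁ 0<a)
    where
    0<a : 0ℤ < a
    0<a = *-pos-cancelˡ 0<h₂ (0<-by 0<ah₂+bh₁ (drop a h₁ h₂))
      where
      drop : ∀ a h₁ h₂ → a * h₂ + 0ℤ * h₁ ≡ h₂ * a
      drop = solve-∀
  ... | tri> _ _ 0<b with ℤₚ.<-cmp a 0ℤ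
  ...   | tri< a<0 _ _ = inj₂ (inj₂ (a<0 , 0<b , 0<-⇒< (*-pos-cancelˡ (*-pos 0<l₂ 0<l₂) (0<-by sum (norm a b l₁ l₂)))))
    where
    sum : 0ℤ < (a * l₂ + b * l₁) * (a * l₂ + b * l₁ + + 2 * (- a * l₂)) + b * b * (+ 5 * (l₂ * l₂) - l₁ * l₁)
    sum = 0<+ (*-pos 0<al₂+bl₁ (0<+ 0<al₂+bl₁ (*-nonNeg (ℤₚ.<⇒≤ (ℤₚ.positive⁻¹ (+ 2)))
                                                         (*-nonNeg (ℤₚ.<⇒≤ (neg-pos a<0)) (ℤₚ.<⇒≤ 0<l₂)))))
              (*-nonNeg (square-nonNeg b) (ℤₚ.<⇒≤ (<⇒0<- l₁²<5l₂²)))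
    norm : ∀ a b l₁ l₂ → (a * l₂ + b * l₁) * (a * l₂ + b * l₁ + + 2 * (- a * l₂)) + b * b * (+ 5 * (l₂ * l₂) - l₁ * l₁)
                         ≡ l₂ * l₂ * (+ 5 * (b * b) - a * a)
    norm = solve-∀
  ...   | tri≈ _ refl _ = inj₁ (ℤₚ.≤-refl , ℤₚ.<⇒≤ 0<b , inj₂ 0<b)
  ...   | tri> _ _ 0<a = inj₁ (ℤₚ.<⇒≤ 0<a , ℤₚ.<⇒≤ 0<b , inj₁ 0<a)

  below≤above : ∀ {s t} → BelowRoot s → AboveRoot t → s ≤ᶠ t
  below≤above {l₁ ∕ l₂} {h₁ ∕ h₂} (0≤l₁ , 0<l₂ , l₁²<5l₂²) (0≤h₁ , 0<h₂ , 5h₂²<h₁²) =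
    ℤₚ.<⇒≤ (square-reflects-< (*-nonNeg 0≤h₁ (ℤₚ.<⇒≤ 0<l₂)) (0<-⇒< (0<-by sum (split l₁ l₂ h₁ h₂))))
    where
    sum : 0ℤ < (h₁ * h₁ - + 5 * (h₂ * h₂)) * (l₂ * l₂) + (+ 5 * (l₂ * l₂) - l₁ * l₁) * (h₂ * h₂)
    sum = ℤₚ.+-mono-< (*-pos (<⇒0<- 5h₂²<h₁²) (*-pos 0<l₂ 0<l₂)) (*-pos (<⇒0<- l₁²<5l₂²) (*-pos 0<h₂ 0<h₂))
    split : ∀ l₁ l₂ h₁ h₂ → (h₁ * h₁ - + 5 * (h₂ * h₂)) * (l₂ * l₂) + (+ 5 * (l₂ * l₂) - l₁ * l₁) * (h₂ * h₂)
                           ≡ h₁ * l₂ * (h₁ * l₂) - l₁ * h₂ * (l₁ * h₂)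
    split = solve-∀

  positive-between : ∀ x {s t u} → 0ℤ < den s → 0ℤ < den t → 0ℤ < den u →
                     s ≤ᶠ t → t ≤ᶠ u → 0ℤ < x at s → 0ℤ < x at u → 0ℤ < x at t
  positive-between (a + b √5) {p₁ ∕ q₁} {p ∕ q} {p₂ ∕ q₂} 0<q₁ 0<q 0<q₂ s≤t t≤u 0<xs 0<xu with b ℤₚ.<? 0ℤ
  ... | yes b<0 = *-pos-cancelˡ 0<q₂ (0<-by (0<+ (*-pos 0<q 0<xu) (*-nonNeg (ℤₚ.<⇒≤ (neg-pos b<0)) (ℤₚ.i≤j⇒0≤j-i t≤u)))
                                           (from-right a b p q p₂ q₂))
    where
    from-right : ∀ a b p q p₂ q₂ → q * (a * q₂ + b * p₂) + - b * (p₂ * q - p * q₂) ≡ q₂ * (a * q + b * p)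
    from-right = solve-∀
  ... | no b≮0 = *-pos-cancelˡ 0<q₁ (0<-by (0<+ (*-pos 0<q 0<xs) (*-nonNeg (ℤₚ.≮⇒≥ b≮0) (ℤₚ.i≤j⇒0≤j-i s≤t)))
                                          (from-left a b p q p₁ q₁))
    where
    from-left : ∀ a b p q p₁ q₁ → q * (a * q₁ + b * p₁) + b * (p * q₁ - p₁ * q) ≡ q₁ * (a * q + b * p)
    from-left = solve-∀

  positive-inside : ∀ {x t} (B : Bracket x) → 0ℤ < den t → low B ≤ᶠ t → t ≤ᶠ high B → 0ℤ < x at t
  positive-inside {x} B 0<den low≤t t≤high =
    positive-between x (proj₁ (proj₂ (low<√5 B))) 0<den (proj₁ (proj₂ (√5<high B)))
                     low≤t t≤high (positive-at-low B) (positive-at-high B)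

  larger-within : ∀ (P : Fraction → Set) s t → P s → P t → Σ[ m ∈ Fraction ] (P m × s ≤ᶠ m × t ≤ᶠ m)
  larger-within P (p ∕ q) (p′ ∕ q′) Ps Pt with p * q′ ℤₚ.≤? p′ * q
  ... | yes s≤t = p′ ∕ q′ , Pt , s≤t , ℤₚ.≤-refl
  ... | no s≰t = p ∕ q , Ps , ℤₚ.≤-refl , ℤₚ.<⇒≤ (ℤₚ.≰⇒> s≰t)

  smaller-within : ∀ (P : Fraction → Set) s t → P s → P t → Σ[ m ∈ Fraction ] (P m × m ≤ᶠ s × m ≤ᶠ t)
  smaller-within P (p ∕ q) (p′ ∕ q′) Ps Pt with p * q′ ℤₚ.≤? p′ * q
  ... | yes s≤t = p ∕ q , Ps , ℤₚ.≤-refl , s≤t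
  ... | no s≰t = p′ ∕ q′ , Pt , ℤₚ.<⇒≤ (ℤₚ.≰⇒> s≰t) , ℤₚ.≤-refl

  ⊕-at : ∀ x y t → (x ⊕ y) at t ≡ x at t + y at t
  ⊕-at (a + b √5) (c + d √5) (p ∕ q) = distrib a b c d p q
    where
    distrib : ∀ a b c d p q → (a + c) * q + (b + d) * p ≡ a * q + b * p + (c * q + d * p)
    distrib = solve-∀

  bracket-⊕ : ∀ {x y} → Bracket x → Bracket y → Bracket (x ⊕ y)
  bracket-⊕ {x} {y} Bx By
    with larger-within BelowRoot (low Bx) (low By) (low<√5 Bx) (low<√5 By)
       | smaller-within AboveRoot (high Bx) (high By) (√5<high Bx) (√5<high By)
  ... | l , l<√5@(_ , 0<l , _) , lx≤l , ly≤l | h , √5<h@(_ , 0<h , _) , h≤hx , h≤hy = record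
    { low = l ; high = h ; low<√5 = l<√5 ; √5<high = √5<h
    ; positive-at-low = 0<-by (ℤₚ.+-mono-< (positive-inside Bx 0<l lx≤l (below≤above l<√5 (√5<high Bx)))
                                           (positive-inside By 0<l ly≤l (below≤above l<√5 (√5<high By))))
                              (sym (⊕-at x y l))
    ; positive-at-high = 0<-by (ℤₚ.+-mono-< (positive-inside Bx 0<h (below≤above (low<√5 Bx) √5<h) h≤hx)
                                            (positive-inside By 0<h (below≤above (low<√5 By) √5<h) h≤hy))
                               (sym (⊕-at x y h)) }

  positive-⊕ : ∀ {x y} → Positive x → Positive y → Positive (x ⊕ y)
  positive-⊕ {x} {y} x>0 y>0 = bracket⇒positive (x ⊕ y) (bracket-⊕ (positive⇒bracket x x>0) (positive⇒bracket y y>0))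

  infix 4 _≺_ _≼_ _≺?_ _≼?_

  record _≺_ (x y : ℤ√5) : Set where
    constructor ≺⁺
    field positive : Positive (y ⊖ x)

  _≼_ : ℤ√5 → ℤ√5 → Set
  x ≼ y = ¬ y ≺ x

  _≺?_ : ∀ x y → Dec (x ≺ y)
  x ≺? y = map′ ≺⁺ _≺_.positive (positive? (y ⊖ x))

  _≼?_ : ∀ x y → Dec (x ≼ y)
  x ≼? y = ¬? (y ≺? x)

  ≺-irrefl : ∀ {x} → ¬ x ≺ x
  ≺-irrefl {a + b √5} (≺⁺ pos) =
    nonPositive-parts (ℤₚ.≤-reflexive (ℤₚ.+-inverseʳ a)) (ℤₚ.≤-reflexive (ℤₚ.+-inverseʳ b)) pos

  ≺-trans : ∀ {x y z} → x ≺ y → y ≺ z → x ≺ z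
  ≺-trans {a + b √5} {c + d √5} {e + f √5} (≺⁺ x≺y) (≺⁺ y≺z) =
    ≺⁺ (subst Positive (cong₂ _+_√5 (telescope e c a) (telescope f d b)) (positive-⊕ y≺z x≺y))
    where
    telescope : ∀ z y x → z - y + (y - x) ≡ z - x
    telescope = solve-∀

  ≺-trichotomy : ∀ x y → x ≺ y ⊎ y ≺ x ⊎ x ≡ y
  ≺-trichotomy (a + b √5) (c + d √5) with positive-trichotomy (c - a) (d - b)
  ... | inj₁ x≺y = inj₁ (≺⁺ x≺y)
  ... | inj₂ (inj₁ y≺x) = inj₂ (inj₁ (≺⁺ (subst₂ (λ r s → Positive (r + s √5)) (flip c a) (flip d b) y≺x)))
    where
    flip : ∀ c a → - (c - a) ≡ a - c
    flip = solve-∀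
  ... | inj₂ (inj₂ (c-a≡0 , d-b≡0)) =
    inj₂ (inj₂ (cong₂ _+_√5 (sym (ℤₚ.i-j≡0⇒i≡j c a c-a≡0)) (sym (ℤₚ.i-j≡0⇒i≡j d b d-b≡0))))

  ≺⇒≼ : ∀ {x y} → x ≺ y → x ≼ y
  ≺⇒≼ x≺y y≺x = ≺-irrefl (≺-trans x≺y y≺x)

  ≼-≺-trans : ∀ {x y z} → x ≼ y → y ≺ z → x ≺ z
  ≼-≺-trans {x} {y} {z} x≼y y≺z with ≺-trichotomy x z
  ... | inj₁ x≺z = x≺z
  ... | inj₂ (inj₁ z≺x) = ⊥-elim (x≼y (≺-trans y≺z z≺x))
  ... | inj₂ (inj₂ refl) = ⊥-elim (x≼y y≺z)

  ≺-≼-trans : ∀ {x y z} → x ≺ y → y ≼ z → x ≺ z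
  ≺-≼-trans {x} {y} {z} x≺y y≼z with ≺-trichotomy x z
  ... | inj₁ x≺z = x≺z
  ... | inj₂ (inj₁ z≺x) = ⊥-elim (y≼z (≺-trans z≺x x≺y))
  ... | inj₂ (inj₂ refl) = ⊥-elim (y≼z x≺y)

  ≼-trans : ∀ {x y z} → x ≼ y → y ≼ z → x ≼ z
  ≼-trans x≼y y≼z z≺x = y≼z (≺-≼-trans z≺x x≼y)

  ⊕-monoʳ-≺ : ∀ {x y} z → x ≺ y → x ⊕ z ≺ y ⊕ z
  ⊕-monoʳ-≺ {a + b √5} {c + d √5} (e + f √5) (≺⁺ pos) =
    ≺⁺ (subst Positive (cong₂ _+_√5 (uncancel c e a) (uncancel d f b)) pos)
    where
    uncancel : ∀ y z x → y - x ≡ y + z - (x + z)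
    uncancel = solve-∀

  ⊕-cancelʳ-≺ : ∀ {x y} z → x ⊕ z ≺ y ⊕ z → x ≺ y
  ⊕-cancelʳ-≺ {a + b √5} {c + d √5} (e + f √5) (≺⁺ pos) =
    ≺⁺ (subst Positive (cong₂ _+_√5 (cancel c e a) (cancel d f b)) pos)
    where
    cancel : ∀ y z x → y + z - (x + z) ≡ y - x
    cancel = solve-∀

  ⊕-monoʳ-≼ : ∀ {x y} z → x ≼ y → x ⊕ z ≼ y ⊕ z
  ⊕-monoʳ-≼ z x≼y y+z≺x+z = x≼y (⊕-cancelʳ-≺ z y+z≺x+z)

  rational-≼ : a ≤ b → a + 0ℤ √5 ≼ b + 0ℤ √5
  rational-≼ a≤b (≺⁺ pos) = nonPositive-parts (ℤₚ.i≤j⇒i-j≤0 a≤b) ℤₚ.≤-refl pos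

module FractionalParts where
  open QuadraticIntegers
  open import Data.Bool using (true; false)
  open import Data.Empty using (⊥-elim)
  open import Data.Integer as ℤ using (ℤ; +_; +[1+_]; -[1+_]; 0ℤ; _+_; _-_; -_; _*_; _<_; _≤_)
  import Data.Integer.Properties as ℤₚ
  open import Data.Integer.Tactic.RingSolver using (solve-∀)
  open import Data.Nat as ℕ using (ℕ)
  import Data.Nat.Properties as ℕₚ
  open import Data.Product using (_×_; _,_; Σ-syntax; ∃-syntax)
  open import Data.Rational.Unnormalised as Q using (0ℚᵘ)
  import Data.Rational.Unnormalised.Properties as Qₚ
  open import Data.Sum as Sum using (_⊎_; inj₁; inj₂)
  open import Function using (_∘_)
  open import Relation.Binary.PropositionalEquality using (_≡_; refl; sym; trans; cong; cong₂; subst; subst₂)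
  open import Relation.Nullary using (¬_; Dec; does; yes; no)
  open import Relation.Nullary.Decidable using (True; from-yes; toWitness)

  -- An element x of ℤ[√5] is read as x / 100 ∈ ℚ(√5), which makes the bounds p / 100 of the statement integral.
  hundredth : ℤ√5 → Q5
  hundredth (a + b √5) = (a Q./ 100) +√5· (b Q./ 100)

  infix 4 _≈₅_
  _≈₅_ : Q5 → Q5 → Set
  u ≈₅ v = re u Q.≃ re v × im u Q.≃ im v

  ≈₅-sym : ∀ {u v} → u ≈₅ v → v ≈₅ u
  ≈₅-sym (r , i) = Qₚ.≃-sym r , Qₚ.≃-sym i

  ≈₅-trans : ∀ {u v w} → u ≈₅ v → v ≈₅ w → u ≈₅ w
  ≈₅-trans (r₁ , i₁) (r₂ , i₂) = Qₚ.≃-trans r₁ r₂ , Qₚ.≃-trans i₁ i₂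

  -₅-cong : ∀ {u u′ v v′} → u ≈₅ u′ → v ≈₅ v′ → u -₅ v ≈₅ u′ -₅ v′
  -₅-cong (r₁ , i₁) (r₂ , i₂) = Qₚ.+-cong r₁ (Qₚ.-‿cong r₂) , Qₚ.+-cong i₁ (Qₚ.-‿cong i₂)

  hundredth-⊖ : ∀ x y → hundredth x -₅ hundredth y ≈₅ hundredth (x ⊖ y)
  hundredth-⊖ (a + b √5) (c + d √5) = Q.*≡* (common a c) , Q.*≡* (common b d)
    where
    common : ∀ a c → (a * + 100 + - c * + 100) * + 100 ≡ (a - c) * + 10000
    common = solve-∀

  pos-resp-≈₅ : ∀ {u v} → u ≈₅ v → Pos u → Pos v
  pos-resp-≈₅ (a≃ , b≃) (inj₁ (0≤a , 0≤b , 0<a⊎0<b)) =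
    inj₁ (Qₚ.≤-respʳ-≃ a≃ 0≤a , Qₚ.≤-respʳ-≃ b≃ 0≤b , Sum.map (Qₚ.<-respʳ-≃ a≃) (Qₚ.<-respʳ-≃ b≃) 0<a⊎0<b)
  pos-resp-≈₅ (a≃ , b≃) (inj₂ (inj₁ (0<a , b<0 , 5b²<a²))) =
    inj₂ (inj₁ (Qₚ.<-respʳ-≃ a≃ 0<a , Qₚ.<-respˡ-≃ b≃ b<0 ,
                Qₚ.<-respʳ-≃ (Qₚ.*-cong a≃ a≃) (Qₚ.<-respˡ-≃ (Qₚ.*-congˡ {(+ 5) Q./ 1} (Qₚ.*-cong b≃ b≃)) 5b²<a²)))
  pos-resp-≈₅ (a≃ , b≃) (inj₂ (inj₂ (a<0 , 0<b , a²<5b²))) =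
    inj₂ (inj₂ (Qₚ.<-respˡ-≃ a≃ a<0 , Qₚ.<-respʳ-≃ b≃ 0<b ,
                Qₚ.<-respʳ-≃ (Qₚ.*-congˡ {(+ 5) Q./ 1} (Qₚ.*-cong b≃ b≃)) (Qₚ.<-respˡ-≃ (Qₚ.*-cong a≃ a≃) a²<5b²)))

  module _ {a : ℤ} where
    hundredth-nonNeg : 0ℚᵘ Q.≤ a Q./ 100 → 0ℤ ≤ a
    hundredth-nonNeg (Q.*≤* 0≤a*1) = subst (0ℤ ≤_) (ℤₚ.*-identityʳ a) 0≤a*1

    nonNeg-hundredth : 0ℤ ≤ a → 0ℚᵘ Q.≤ a Q./ 100
    nonNeg-hundredth 0≤a = Q.*≤* (subst (0ℤ ≤_) (sym (ℤₚ.*-identityʳ a)) 0≤a)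

    hundredth-pos : 0ℚᵘ Q.< a Q./ 100 → 0ℤ < a
    hundredth-pos (Q.*<* 0<a*1) = subst (0ℤ <_) (ℤₚ.*-identityʳ a) 0<a*1

    pos-hundredth : 0ℤ < a → 0ℚᵘ Q.< a Q./ 100
    pos-hundredth 0<a = Q.*<* (subst (0ℤ <_) (sym (ℤₚ.*-identityʳ a)) 0<a)

    hundredth-neg : a Q./ 100 Q.< 0ℚᵘ → a < 0ℤ
    hundredth-neg (Q.*<* a*1<0) = subst (_< 0ℤ) (ℤₚ.*-identityʳ a) a*1<0

    neg-hundredth : a < 0ℤ → a Q./ 100 Q.< 0ℚᵘ
    neg-hundredth a<0 = Q.*<* (subst (_< 0ℤ) (sym (ℤₚ.*-identityʳ a)) a<0)

  unscale : ∀ a c → a * + 10000 < c * + 10000 → a < c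
  unscale _ _ = ℤₚ.*-cancelʳ-<-nonNeg (+ 10000)

  scale : ∀ a c → a < c → a * + 10000 < c * + 10000
  scale _ _ = ℤₚ.*-monoʳ-<-pos (+ 10000)

  pos-hundredth⇒positive : ∀ x → Pos (hundredth x) → Positive x
  pos-hundredth⇒positive (a + b √5) (inj₁ (0≤a , 0≤b , 0<a⊎0<b)) =
    inj₁ (hundredth-nonNeg 0≤a , hundredth-nonNeg 0≤b , Sum.map hundredth-pos hundredth-pos 0<a⊎0<b)
  pos-hundredth⇒positive (a + b √5) (inj₂ (inj₁ (0<a , b<0 , Q.*<* 5b²<a²))) =
    inj₂ (inj₁ (hundredth-pos 0<a , hundredth-neg b<0 , unscale (+ 5 * (b * b)) (a * a) 5b²<a²))
  pos-hundredth⇒positive (a + b √5) (inj₂ (inj₂ (a<0 , 0<b , Q.*<* a²<5b²))) =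
    inj₂ (inj₂ (hundredth-neg a<0 , hundredth-pos 0<b , unscale (a * a) (+ 5 * (b * b)) a²<5b²))

  positive⇒pos-hundredth : ∀ x → Positive x → Pos (hundredth x)
  positive⇒pos-hundredth (a + b √5) (inj₁ (0≤a , 0≤b , 0<a⊎0<b)) =
    inj₁ (nonNeg-hundredth 0≤a , nonNeg-hundredth 0≤b , Sum.map pos-hundredth pos-hundredth 0<a⊎0<b)
  positive⇒pos-hundredth (a + b √5) (inj₂ (inj₁ (0<a , b<0 , 5b²<a²))) =
    inj₂ (inj₁ (pos-hundredth 0<a , neg-hundredth b<0 , Q.*<* (scale (+ 5 * (b * b)) (a * a) 5b²<a²)))
  positive⇒pos-hundredth (a + b √5) (inj₂ (inj₂ (a<0 , 0<b , a²<5b²))) =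
    inj₂ (inj₂ (neg-hundredth a<0 , pos-hundredth 0<b , Q.*<* (scale (a * a) (+ 5 * (b * b)) a²<5b²)))

  module _ {u v x y} (u≈x : u ≈₅ hundredth x) (v≈y : v ≈₅ hundredth y) where
    private
      v-u≈y⊖x : v -₅ u ≈₅ hundredth (y ⊖ x)
      v-u≈y⊖x = ≈₅-trans (-₅-cong v≈y u≈x) (hundredth-⊖ y x)

    <₅⇒≺ : u <₅ v → x ≺ y
    <₅⇒≺ u<v = ≺⁺ (pos-hundredth⇒positive (y ⊖ x) (pos-resp-≈₅ v-u≈y⊖x u<v))

    ≺⇒<₅ : x ≺ y → u <₅ v
    ≺⇒<₅ (≺⁺ x≺y) = pos-resp-≈₅ (≈₅-sym v-u≈y⊖x) (positive⇒pos-hundredth (y ⊖ x) x≺y)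

  0′ 1′ θ′ : ℤ√5
  0′ = 0ℤ + 0ℤ √5
  1′ = + 100 + 0ℤ √5
  θ′ = + 50 - + 10 √5

  ofℕ′ pct′ : ℕ → ℤ√5
  ofℕ′ j = (+ 100 * + j) + 0ℤ √5
  pct′ p = + p + 0ℤ √5

  φ′ : ℤ → ℤ√5
  φ′ k = (+ 50 * k) + (+ 50 * k) √5

  ofℕ≈ : ∀ j → ofℕ j ≈₅ hundredth (ofℕ′ j)
  ofℕ≈ j = Q.*≡* (scaled (+ j)) , Q.*≡* refl
    where
    scaled : ∀ j → j * + 100 ≡ + 100 * j * + 1
    scaled = solve-∀

  φ·≈ : ∀ n → φ· n ≈₅ hundredth (φ′ (+ n))
  φ·≈ n = Q.*≡* (scaled (+ n)) , Q.*≡* (scaled (+ n))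
    where
    scaled : ∀ n → n * + 100 ≡ + 50 * n * + 2
    scaled = solve-∀

  θ≈ : θ ≈₅ hundredth θ′
  θ≈ = Q.*≡* refl , Q.*≡* refl

  pct≈ : ∀ p → pct p ≈₅ hundredth (pct′ p)
  pct≈ p = Qₚ.≃-refl , Q.*≡* refl

  infix 4 _∈[_,_⟩
  _∈[_,_⟩ : ℤ√5 → ℤ√5 → ℤ√5 → Set
  x ∈[ lo , hi ⟩ = lo ≼ x × x ≺ hi

  ≼⇒0≼⊖ : ∀ {x y} → x ≼ y → 0′ ≼ y ⊖ x
  ≼⇒0≼⊖ {a + b √5} {c + d √5} x≼y (≺⁺ pos) =
    x≼y (≺⁺ (subst₂ (λ r s → Positive (r + s √5)) (flip c a) (flip d b) pos))
    where
    flip : ∀ c a → 0ℤ - (c - a) ≡ a - c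
    flip = solve-∀

  ≺⊕⇒⊖≺ : ∀ {x y w} → y ≺ x ⊕ w → y ⊖ x ≺ w
  ≺⊕⇒⊖≺ {a + b √5} {c + d √5} {e + f √5} (≺⁺ pos) =
    ≺⁺ (subst₂ (λ r s → Positive (r + s √5)) (regroup a e c) (regroup b f d) pos)
    where
    regroup : ∀ a e c → a + e - c ≡ e - (c - a)
    regroup = solve-∀

  window : ∀ {x y} → x ≼ y → y ≺ x ⊕ 1′ → y ⊖ x ∈[ 0′ , 1′ ⟩
  window x≼y y≺x+1 = ≼⇒0≼⊖ x≼y , ≺⊕⇒⊖≺ y≺x+1

  0′⊕ : ∀ x → 0′ ⊕ x ≡ x
  0′⊕ (a + b √5) = cong₂ _+_√5 (ℤₚ.+-identityˡ a) (ℤₚ.+-identityˡ b)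

  x≺x⊕1′ : ∀ x → x ≺ x ⊕ 1′
  x≺x⊕1′ (a + b √5) =
    ≺⁺ (subst₂ (λ r s → Positive (r + s √5)) (sym (step a)) (sym (no-step b)) (from-yes (positive? 1′)))
    where
    step : ∀ a → a + + 100 - a ≡ + 100
    step = solve-∀
    no-step : ∀ b → b + 0ℤ - b ≡ 0ℤ
    no-step = solve-∀

  ofℕ′-suc : ∀ j → ofℕ′ (ℕ.suc j) ≡ ofℕ′ j ⊕ 1′
  ofℕ′-suc j = cong (_+ 0ℤ √5) (trans (cong (+ 100 *_) (ℤₚ.pos-+ 1 j)) (distrib (+ j)))
    where
    distrib : ∀ j → + 100 * (+ 1 + j) ≡ + 100 * j + + 100
    distrib = solve-∀

  ofℕ′-mono-≼ : ∀ {j k} → j ℕ.≤ k → ofℕ′ j ≼ ofℕ′ k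
  ofℕ′-mono-≼ j≤k = rational-≼ (ℤₚ.*-monoˡ-≤-nonNeg (+ 100) (ℤ.+≤+ j≤k))

  φ′-nonNeg : ∀ n → 0′ ≼ φ′ (+ n)
  φ′-nonNeg n (≺⁺ pos) = nonPositive-parts 0-φn≤0 0-φn≤0 pos
    where
    0-φn≤0 : 0ℤ - + 50 * + n ≤ 0ℤ
    0-φn≤0 = ℤₚ.i≤j⇒i-j≤0 (*-nonNeg (ℤₚ.<⇒≤ (ℤₚ.positive⁻¹ (+ 50))) (ℤ.+≤+ (ℕ.z≤n {n})))

  φ′-bound : ∀ n → φ′ (+ n) ≼ ofℕ′ (2 ℕ.* n)
  φ′-bound n (≺⁺ pos) =
    nonPositive-norm rational≤0 norm≤ (subst (λ r → Positive ((+ 50 * + n - r) + (+ 50 * + n - 0ℤ) √5))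
                                             (cong (+ 100 *_) (ℤₚ.pos-* 2 n)) pos)
    where
    rational≤0 : + 50 * + n - + 100 * (+ 2 * + n) ≤ 0ℤ
    rational≤0 = subst (_≤ 0ℤ) (sym (negative (+ n)))
                       (ℤₚ.neg-mono-≤ (*-nonNeg (ℤₚ.<⇒≤ (ℤₚ.positive⁻¹ (+ 150))) (ℤ.+≤+ (ℕ.z≤n {n}))))
      where
      negative : ∀ n → + 50 * n - + 100 * (+ 2 * n) ≡ - (+ 150 * n)
      negative = solve-∀
    norm≤ : + 5 * ((+ 50 * + n - 0ℤ) * (+ 50 * + n - 0ℤ))
            ≤ (+ 50 * + n - + 100 * (+ 2 * + n)) * (+ 50 * + n - + 100 * (+ 2 * + n))
    norm≤ = ℤₚ.0≤i-j⇒j≤i (0≤-by (*-nonNeg (ℤₚ.<⇒≤ (ℤₚ.positive⁻¹ (+ 10000))) (square-nonNeg (+ n))) (gap (+ n)))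
      where
      gap : ∀ n → + 10000 * (n * n)
                  ≡ (+ 50 * n - + 100 * (+ 2 * n)) * (+ 50 * n - + 100 * (+ 2 * n))
                    - + 5 * ((+ 50 * n - 0ℤ) * (+ 50 * n - 0ℤ))
      gap = solve-∀

  -- ⌊φ· n ⌋ and ⌈φ· n ⌉ are counts made by functions private to Defs; abstracting their bound 2 n
  -- with `with` leaves a constraint from which unification recovers those functions. Beware the
  -- offset: floorCount n m counts the 1 ≤ k ≤ m with k ≤ φ n, ceilCount n m the 0 ≤ k ≤ m with k < φ n.
  mutual
    floorCount : ℕ → ℕ → ℕ
    floorCount n m = _

    ⌊φ·⌋≡floorCount : ∀ n → ⌊φ· n ⌋ ≡ floorCount n (2 ℕ.* n)
    ⌊φ·⌋≡floorCount n with 2 ℕ.* n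
    ... | _ = refl

  mutual
    ceilCount : ℕ → ℕ → ℕ
    ceilCount n m = _

    ⌈φ·⌉≡ceilCount : ∀ n → ⌈φ· n ⌉ ≡ ceilCount n (2 ℕ.* n)
    ⌈φ·⌉≡ceilCount n with 2 ℕ.* n
    ... | _ = refl

  from-does-true : ∀ {A : Set} (a? : Dec A) → does a? ≡ true → A
  from-does-true (yes a) _ = a
  from-does-true (no _) ()

  from-does-false : ∀ {A : Set} (a? : Dec A) → does a? ≡ false → ¬ A
  from-does-false (yes _) ()
  from-does-false (no ¬a) _ = ¬a

  floor-step : ∀ n m → (ofℕ′ (ℕ.suc m) ≼ φ′ (+ n) × floorCount n (ℕ.suc m) ≡ ℕ.suc (floorCount n m))
                     ⊎ (φ′ (+ n) ≺ ofℕ′ (ℕ.suc m) × floorCount n (ℕ.suc m) ≡ floorCount n m)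
  floor-step n m with does (Pos? (ofℕ (ℕ.suc m) -₅ φ· n)) in eq
  ... | true = inj₂ (<₅⇒≺ (φ·≈ n) (ofℕ≈ (ℕ.suc m)) (from-does-true (Pos? _) eq) , refl)
  ... | false = inj₁ (from-does-false (Pos? _) eq ∘ ≺⇒<₅ (φ·≈ n) (ofℕ≈ (ℕ.suc m)) , refl)

  ceil-first : ∀ n → (ofℕ′ 0 ≺ φ′ (+ n) × ceilCount n 0 ≡ 1) ⊎ (φ′ (+ n) ≼ ofℕ′ 0 × ceilCount n 0 ≡ 0)
  ceil-first n with does (Pos? (φ· n -₅ ofℕ 0)) in eq
  ... | true = inj₁ (<₅⇒≺ (ofℕ≈ 0) (φ·≈ n) (from-does-true (Pos? _) eq) , refl)
  ... | false = inj₂ (from-does-false (Pos? _) eq ∘ ≺⇒<₅ (ofℕ≈ 0) (φ·≈ n) , refl)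

  ceil-step : ∀ n m → (ofℕ′ (ℕ.suc m) ≺ φ′ (+ n) × ceilCount n (ℕ.suc m) ≡ ℕ.suc (ceilCount n m))
                    ⊎ (φ′ (+ n) ≼ ofℕ′ (ℕ.suc m) × ceilCount n (ℕ.suc m) ≡ ceilCount n m)
  ceil-step n m with does (Pos? (φ· n -₅ ofℕ (ℕ.suc m))) in eq
  ... | true = inj₁ (<₅⇒≺ (ofℕ≈ (ℕ.suc m)) (φ·≈ n) (from-does-true (Pos? _) eq) , refl)
  ... | false = inj₂ (from-does-false (Pos? _) eq ∘ ≺⇒<₅ (ofℕ≈ (ℕ.suc m)) (φ·≈ n) , refl)

  FloorInvariant : ℕ → ℕ → ℕ → Set
  FloorInvariant n m K = K ℕ.≤ m × ofℕ′ K ≼ φ′ (+ n) × (K ≡ m ⊎ φ′ (+ n) ≺ ofℕ′ (ℕ.suc K))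

  floor-invariant-step : ∀ n m {K K′} →
    (ofℕ′ (ℕ.suc m) ≼ φ′ (+ n) × K′ ≡ ℕ.suc K) ⊎ (φ′ (+ n) ≺ ofℕ′ (ℕ.suc m) × K′ ≡ K) →
    FloorInvariant n m K → FloorInvariant n (ℕ.suc m) K′
  floor-invariant-step n m (inj₁ (m+1≼φn , refl)) (K≤m , _ , inj₁ refl) = ℕ.s≤s K≤m , m+1≼φn , inj₁ refl
  floor-invariant-step n m (inj₁ (m+1≼φn , refl)) (K≤m , _ , inj₂ φn<K+1) =
    ⊥-elim (m+1≼φn (≺-≼-trans φn<K+1 (ofℕ′-mono-≼ (ℕ.s≤s K≤m))))
  floor-invariant-step n m (inj₂ (φn<m+1 , refl)) (K≤m , K≼φn , inj₁ refl) = ℕₚ.m≤n⇒m≤1+n K≤m , K≼φn , inj₂ φn<m+1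
  floor-invariant-step n m (inj₂ (φn<m+1 , refl)) (K≤m , K≼φn , inj₂ φn<K+1) = ℕₚ.m≤n⇒m≤1+n K≤m , K≼φn , inj₂ φn<K+1

  floor-invariant : ∀ n m → FloorInvariant n m (floorCount n m)
  floor-invariant n ℕ.zero = ℕ.z≤n , φ′-nonNeg n , inj₁ refl
  floor-invariant n (ℕ.suc m) = floor-invariant-step n m (floor-step n m) (floor-invariant n m)

  δ′ : ℕ → ℤ√5
  δ′ n = φ′ (+ n) ⊖ ofℕ′ ⌊φ· n ⌋

  δ′-window : ∀ n → δ′ n ∈[ 0′ , 1′ ⟩
  δ′-window n = subst (λ K → φ′ (+ n) ⊖ ofℕ′ K ∈[ 0′ , 1′ ⟩) (sym (⌊φ·⌋≡floorCount n))
                      (at-end (floor-invariant n (2 ℕ.* n)))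
    where
    at-end : ∀ {K} → FloorInvariant n (2 ℕ.* n) K → φ′ (+ n) ⊖ ofℕ′ K ∈[ 0′ , 1′ ⟩
    at-end (_ , K≼φn , inj₁ refl) = window K≼φn (≼-≺-trans (φ′-bound n) (x≺x⊕1′ _))
    at-end (_ , K≼φn , inj₂ φn<K+1) = window K≼φn (subst (φ′ (+ n) ≺_) (ofℕ′-suc _) φn<K+1)

  CeilInvariant : ℕ → ℕ → ℕ → Set
  CeilInvariant n m K = K ℕ.≤ m × (K ≡ m ⊎ φ′ (+ n) ≼ ofℕ′ K) × ofℕ′ K ≺ φ′ (+ n) ⊕ 1′

  ceil-invariant-step : ∀ n m {K K′} →
    (ofℕ′ m ≺ φ′ (+ n) × K′ ≡ ℕ.suc K) ⊎ (φ′ (+ n) ≼ ofℕ′ m × K′ ≡ K) →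
    CeilInvariant n m K → CeilInvariant n (ℕ.suc m) K′
  ceil-invariant-step n m (inj₁ (m<φn , refl)) (K≤m , inj₁ refl , _) =
    ℕ.s≤s K≤m , inj₁ refl , subst (_≺ φ′ (+ n) ⊕ 1′) (sym (ofℕ′-suc m)) (⊕-monoʳ-≺ 1′ m<φn)
  ceil-invariant-step n m (inj₁ (m<φn , refl)) (K≤m , inj₂ φn≼K , _) =
    ⊥-elim (≺-irrefl (≺-≼-trans (≺-≼-trans m<φn φn≼K) (ofℕ′-mono-≼ K≤m)))
  ceil-invariant-step n m (inj₂ (φn≼m , refl)) (K≤m , inj₁ refl , K<φn+1) = ℕₚ.m≤n⇒m≤1+n K≤m , inj₂ φn≼m , K<φn+1
  ceil-invariant-step n m (inj₂ (φn≼m , refl)) (K≤m , inj₂ φn≼K , K<φn+1) = ℕₚ.m≤n⇒m≤1+n K≤m , inj₂ φn≼K , K<φn+1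

  ceil-invariant : ∀ n m → CeilInvariant n (ℕ.suc m) (ceilCount n m)
  ceil-invariant n ℕ.zero =
    ceil-invariant-step n 0 (ceil-first n)
      (ℕ.z≤n , inj₁ refl , ≺-≼-trans (from-yes (0′ ≺? 1′)) (⊕-monoʳ-≼ 1′ (φ′-nonNeg n)))
  ceil-invariant n (ℕ.suc m) = ceil-invariant-step n (ℕ.suc m) (ceil-step n m) (ceil-invariant n m)

  Δ′ : ℕ → ℤ√5
  Δ′ n = ofℕ′ ⌈φ· n ⌉ ⊖ φ′ (+ n)

  Δ′-window : ∀ n → Δ′ n ∈[ 0′ , 1′ ⟩
  Δ′-window n = subst (λ K → ofℕ′ K ⊖ φ′ (+ n) ∈[ 0′ , 1′ ⟩) (sym (⌈φ·⌉≡ceilCount n))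
                      (at-end (ceil-invariant n (2 ℕ.* n)))
    where
    at-end : ∀ {K} → CeilInvariant n (ℕ.suc (2 ℕ.* n)) K → ofℕ′ K ⊖ φ′ (+ n) ∈[ 0′ , 1′ ⟩
    at-end (_ , inj₁ refl , K<φn+1) =
      ⊥-elim (φ′-bound n (⊕-cancelʳ-≺ 1′ (subst (_≺ φ′ (+ n) ⊕ 1′) (ofℕ′-suc (2 ℕ.* n)) K<φn+1)))
    at-end (_ , inj₂ φn≼K , K<φn+1) = window φn≼K K<φn+1

  infix 4 _≡_modℤ
  _≡_modℤ : ℤ√5 → ℤ√5 → Set
  y ≡ z modℤ = Σ[ J ∈ ℤ ] y ≡ z ⊕ (+ 100 * J + 0ℤ √5)

  modℤ-unique : ∀ {y z} → y ∈[ 0′ , 1′ ⟩ → z ∈[ 0′ , 1′ ⟩ → y ≡ z modℤ → y ≡ z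
  modℤ-unique {z = c + d √5} _ _ (+ 0 , refl) = cong₂ _+_√5 (ℤₚ.+-identityʳ c) (ℤₚ.+-identityʳ d)
  modℤ-unique {z = z} (_ , y≺1) (0≼z , _) (J@(+[1+ _ ]) , refl) = ⊥-elim (≼-trans 1≼w w≼z⊕w y≺1)
    where
    w : ℤ√5
    w = + 100 * J + 0ℤ √5
    1≼w : 1′ ≼ w
    1≼w = rational-≼ (ℤₚ.*-monoˡ-≤-nonNeg (+ 100) (ℤ.+≤+ (ℕ.s≤s ℕ.z≤n)))
    w≼z⊕w : w ≼ z ⊕ w
    w≼z⊕w = subst (_≼ z ⊕ w) (0′⊕ w) (⊕-monoʳ-≼ w 0≼z)
  modℤ-unique {z = z} (0≼y , _) (_ , z≺1) (J@(-[1+ k ]) , refl) =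
    ⊥-elim (0≼y (≺-≼-trans (⊕-monoʳ-≺ w z≺1) 1⊕w≼0))
    where
    w : ℤ√5
    w = + 100 * J + 0ℤ √5
    1⊕w≼0 : 1′ ⊕ w ≼ 0′
    1⊕w≼0 = rational-≼ (ℤₚ.+-monoʳ-≤ (+ 100) (ℤₚ.*-monoˡ-≤-nonNeg (+ 100) (ℤ.-≤- (ℕ.z≤n {k}))))

  -- If x lies in [lo, hi) and x + s ≡ y (mod 1) with y ∈ [0, 1), then y is x + s itself,
  -- so y < b as soon as [lo + s, hi + s) ⊆ [0, b].
  cell : ∀ {x y s lo hi b} → x ∈[ lo , hi ⟩ → 0′ ≼ lo ⊕ s → hi ⊕ s ≼ b → b ≼ 1′ →
         y ∈[ 0′ , 1′ ⟩ → y ≡ x ⊕ s modℤ → y ≺ b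
  cell {x} {y} {s} {b = b} (lo≼x , x≺hi) 0≼lo+s hi+s≼b b≼1 y∈ y≡x+s =
    subst (_≺ b) (sym (modℤ-unique y∈ (≼-trans 0≼lo+s (⊕-monoʳ-≼ s lo≼x) , ≺-≼-trans x+s≺b b≼1) y≡x+s)) x+s≺b
    where
    x+s≺b : x ⊕ s ≺ b
    x+s≺b = ≺-≼-trans (⊕-monoʳ-≺ s x≺hi) hi+s≼b

  shift : ℤ → ℤ → ℤ√5
  shift ℓ J₀ = φ′ ℓ ⊕ (+ 100 * J₀ + 0ℤ √5)

  δ′-shift : ∀ n ℓ J₀ → δ′ (n ℕ.+ ℓ) ≡ δ′ n ⊕ shift (+ ℓ) J₀ modℤ
  δ′-shift n ℓ J₀ = + ⌊φ· n ⌋ - + ⌊φ· n ℕ.+ ℓ ⌋ - J₀ ,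
    cong₂ _+_√5 (trans (cong (λ m → + 50 * m - + 100 * + ⌊φ· n ℕ.+ ℓ ⌋) (ℤₚ.pos-+ n ℓ))
                       (rational (+ n) (+ ℓ) (+ ⌊φ· n ⌋) (+ ⌊φ· n ℕ.+ ℓ ⌋) J₀))
                (trans (cong (λ m → + 50 * m - 0ℤ) (ℤₚ.pos-+ n ℓ)) (surd (+ n) (+ ℓ)))
    where
    rational : ∀ n ℓ k k′ J₀ → + 50 * (n + ℓ) - + 100 * k′
                               ≡ + 50 * n - + 100 * k + (+ 50 * ℓ + + 100 * J₀) + + 100 * (k - k′ - J₀)
    rational = solve-∀
    surd : ∀ n ℓ → + 50 * (n + ℓ) - 0ℤ ≡ + 50 * n - 0ℤ + (+ 50 * ℓ + 0ℤ) + 0ℤ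
    surd = solve-∀

  Δ′-shift : ∀ n ℓ J₀ → Δ′ (n ℕ.+ ℓ) ≡ Δ′ n ⊕ shift (- + ℓ) J₀ modℤ
  Δ′-shift n ℓ J₀ = + ⌈φ· n ℕ.+ ℓ ⌉ - + ⌈φ· n ⌉ - J₀ ,
    cong₂ _+_√5 (trans (cong (λ m → + 100 * + ⌈φ· n ℕ.+ ℓ ⌉ - + 50 * m) (ℤₚ.pos-+ n ℓ))
                       (rational (+ n) (+ ℓ) (+ ⌈φ· n ⌉) (+ ⌈φ· n ℕ.+ ℓ ⌉) J₀))
                (trans (cong (λ m → 0ℤ - + 50 * m) (ℤₚ.pos-+ n ℓ)) (surd (+ n) (+ ℓ)))
    where
    rational : ∀ n ℓ k k′ J₀ → + 100 * k′ - + 50 * (n + ℓ)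
                               ≡ + 100 * k - + 50 * n + (+ 50 * - ℓ + + 100 * J₀) + + 100 * (k′ - k - J₀)
    rational = solve-∀
    surd : ∀ n ℓ → 0ℤ - + 50 * (n + ℓ) ≡ 0ℤ - + 50 * n + (+ 50 * - ℓ + 0ℤ) + 0ℤ
    surd = solve-∀

  δ≈ : ∀ n → δ n ≈₅ hundredth (δ′ n)
  δ≈ n = ≈₅-trans (-₅-cong (φ·≈ n) (ofℕ≈ ⌊φ· n ⌋)) (hundredth-⊖ (φ′ (+ n)) (ofℕ′ ⌊φ· n ⌋))

  Δ≈ : ∀ n → Δ n ≈₅ hundredth (Δ′ n)
  Δ≈ n = ≈₅-trans (-₅-cong (ofℕ≈ ⌈φ· n ⌉) (φ·≈ n)) (hundredth-⊖ (ofℕ′ ⌈φ· n ⌉) (φ′ (+ n)))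

  θ′≼1′ : θ′ ≼ 1′
  θ′≼1′ = from-yes (θ′ ≼? 1′)

  subdivide : ∀ {A : Set} {x a b} → x ∈[ a , b ⟩ → ∀ c → (x ∈[ a , c ⟩ → A) → (x ∈[ c , b ⟩ → A) → A
  subdivide {x = x} (a≼x , x≺b) c below above with x ≺? c
  ... | yes x≺c = below (a≼x , x≺c)
  ... | no x⊀c = above (x⊀c , x≺b)

  ReturnsBelowθ : ℕ → (ℕ → Q5) → ℕ → Set
  ReturnsBelowθ m f n = ∃[ ℓ ] (1 ℕ.≤ ℓ × ℓ ℕ.≤ m × f (n ℕ.+ ℓ) <₅ θ)

  ReturnsTwiceBelowθ : ℕ → (ℕ → Q5) → ℕ → Set
  ReturnsTwiceBelowθ m f n =
    ∃[ ℓ ] ∃[ ℓ′ ] (1 ℕ.≤ ℓ × ℓ ℕ.< ℓ′ × ℓ′ ℕ.≤ m × f (n ℕ.+ ℓ) <₅ θ × f (n ℕ.+ ℓ′) <₅ θ)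

  record Rotation (f : ℕ → Q5) : Set where
    field
      f′ : ℕ → ℤ√5
      direction : ℕ → ℤ
      represents : ∀ n → f n ≈₅ hundredth (f′ n)
      in-window : ∀ n → f′ n ∈[ 0′ , 1′ ⟩
      rotates : ∀ n ℓ J₀ → f′ (n ℕ.+ ℓ) ≡ f′ n ⊕ shift (direction ℓ) J₀ modℤ

  δ-rotation : Rotation δ
  δ-rotation = record
    { f′ = δ′ ; direction = +_ ; represents = δ≈ ; in-window = δ′-window ; rotates = δ′-shift }

  Δ-rotation : Rotation Δ
  Δ-rotation = record
    { f′ = Δ′ ; direction = λ ℓ → - + ℓ ; represents = Δ≈ ; in-window = Δ′-window ; rotates = Δ′-shift }

  -- pick ℓ J₀ settles a piece [lo, hi) of [0, 1) on which f (n + ℓ) = f n ± ℓ φ + J₀ holds without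
  -- reduction mod 1; its side conditions are closed and decided by evaluation.
  module Cells {f} (R : Rotation f) (n : ℕ) where
    open Rotation R

    below-θ : ∀ {lo hi} ℓ J₀ →
              {True (0′ ≼? lo ⊕ shift (direction ℓ) J₀)} → {True (hi ⊕ shift (direction ℓ) J₀ ≼? θ′)} →
              f′ n ∈[ lo , hi ⟩ → f (n ℕ.+ ℓ) <₅ θ
    below-θ ℓ J₀ {lo-ok} {hi-ok} fn∈ =
      ≺⇒<₅ (represents (n ℕ.+ ℓ)) θ≈
           (cell fn∈ (toWitness lo-ok) (toWitness hi-ok) θ′≼1′ (in-window (n ℕ.+ ℓ)) (rotates n ℓ J₀))

    pick : ∀ {m lo hi} ℓ J₀ → {True (1 ℕ.≤? ℓ)} → {True (ℓ ℕ.≤? m)} →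
           {True (0′ ≼? lo ⊕ shift (direction ℓ) J₀)} → {True (hi ⊕ shift (direction ℓ) J₀ ≼? θ′)} →
           f′ n ∈[ lo , hi ⟩ → ReturnsBelowθ m f n
    pick ℓ J₀ {1≤ℓ} {ℓ≤m} {lo-ok} {hi-ok} fn∈ = ℓ , toWitness 1≤ℓ , toWitness ℓ≤m , below-θ ℓ J₀ {lo-ok} {hi-ok} fn∈

    pick₂ : ∀ {m lo hi} ℓ J₀ ℓ′ J₀′ → {True (1 ℕ.≤? ℓ)} → {True (ℓ ℕ.<? ℓ′)} → {True (ℓ′ ℕ.≤? m)} →
            {True (0′ ≼? lo ⊕ shift (direction ℓ) J₀)} → {True (hi ⊕ shift (direction ℓ) J₀ ≼? θ′)} →
            {True (0′ ≼? lo ⊕ shift (direction ℓ′) J₀′)} → {True (hi ⊕ shift (direction ℓ′) J₀′ ≼? θ′)} →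
            f′ n ∈[ lo , hi ⟩ → ReturnsTwiceBelowθ m f n
    pick₂ ℓ J₀ ℓ′ J₀′ {1≤ℓ} {ℓ<ℓ′} {ℓ′≤m} {lo-ok} {hi-ok} {lo-ok′} {hi-ok′} fn∈ =
      ℓ , ℓ′ , toWitness 1≤ℓ , toWitness ℓ<ℓ′ , toWitness ℓ′≤m ,
      below-θ ℓ J₀ {lo-ok} {hi-ok} fn∈ , below-θ ℓ′ J₀′ {lo-ok′} {hi-ok′} fn∈

    Ico-from : ∀ {p q} → f′ n ∈[ pct′ p , pct′ q ⟩ → Ico p q (f n)
    Ico-from {p} {q} (p≼x , x≺q) = p≼x ∘ <₅⇒≺ (represents n) (pct≈ p) , ≺⇒<₅ (represents n) (pct≈ q) x≺q

    Ioo-from : ∀ p {q c} → {True (pct′ p ≺? c)} → f′ n ∈[ c , pct′ q ⟩ → Ioo p q (f n)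
    Ioo-from p {q} {_} {p≺c} (c≼x , x≺q) =
      ≺⇒<₅ (pct≈ p) (represents n) (≺-≼-trans (toWitness p≺c) c≼x) , ≺⇒<₅ (represents n) (pct≈ q) x≺q

    Ioc-from : ∀ p {c} → {True (pct′ p ≺? c)} → f′ n ∈[ c , 1′ ⟩ → Ioc p 100 (f n)
    Ioc-from p {_} {p≺c} (c≼x , x≺1) =
      ≺⇒<₅ (pct≈ p) (represents n) (≺-≼-trans (toWitness p≺c) c≼x) , ≺⇒≼ x≺1 ∘ <₅⇒≺ (pct≈ 100) (represents n)

  δ-returns-within-5 : ∀ n → ReturnsBelowθ 5 δ n
  δ-returns-within-5 n =
    subdivide (δ′-window n) (+ 600 - + 260 √5) (pick 5 (- + 8)) λ δ∈ →
    subdivide δ∈ (+ 400 - + 160 √5) (pick 3 (- + 5)) λ δ∈ →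
    subdivide δ∈ (+ 200 - + 60 √5) (pick 1 (- + 2)) λ δ∈ →
    subdivide δ∈ (+ 550 - + 210 √5) (pick 4 (- + 7)) (pick 2 (- + 4))
    where open Cells δ-rotation n

  δ-returns-within-3 : ∀ n → ¬ (Ico 0 15 (δ n) ⊎ Ioo 65 77 (δ n)) → ReturnsBelowθ 3 δ n
  δ-returns-within-3 n excluded =
    subdivide (δ′-window n) (pct′ 15) (λ δ∈ → ⊥-elim (excluded (inj₁ (Ico-from δ∈)))) λ δ∈ →
    subdivide δ∈ (+ 400 - + 160 √5) (pick 3 (- + 5)) λ δ∈ →
    subdivide δ∈ (+ 200 - + 60 √5) (pick 1 (- + 2)) λ δ∈ →
    subdivide δ∈ (pct′ 77) (λ δ∈ → ⊥-elim (excluded (inj₂ (Ioo-from 65 δ∈)))) (pick 2 (- + 4))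
    where open Cells δ-rotation n

  δ-returns-twice-within-6 : ∀ n → ¬ (Ico 0 30 (δ n) ⊎ Ioc 65 100 (δ n)) → ReturnsTwiceBelowθ 6 δ n
  δ-returns-twice-within-6 n excluded =
    subdivide (δ′-window n) (pct′ 30) (λ δ∈ → ⊥-elim (excluded (inj₁ (Ico-from δ∈)))) λ δ∈ →
    subdivide δ∈ (+ 400 - + 160 √5) (pick₂ 3 (- + 5) 6 (- + 10)) λ δ∈ →
    subdivide δ∈ (+ 750 - + 310 √5) (pick₂ 1 (- + 2) 6 (- + 10)) λ δ∈ →
    subdivide δ∈ (+ 200 - + 60 √5) (pick₂ 1 (- + 2) 4 (- + 7)) (λ δ∈ → ⊥-elim (excluded (inj₂ (Ioc-from 65 δ∈))))
    where open Cells δ-rotation n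

  Δ-returns-within-5 : ∀ n → ReturnsBelowθ 5 Δ n
  Δ-returns-within-5 n =
    subdivide (Δ′-window n) (- + 300 + + 140 √5) (pick 3 (+ 5)) λ Δ∈ →
    subdivide Δ∈ (- + 500 + + 240 √5) (pick 5 (+ 8)) λ Δ∈ →
    subdivide Δ∈ (- + 150 + + 90 √5) (pick 2 (+ 3)) λ Δ∈ →
    subdivide Δ∈ (- + 350 + + 190 √5) (pick 4 (+ 6)) λ Δ∈ →
    subdivide Δ∈ (0ℤ + + 40 √5) (pick 1 (+ 1)) (pick 3 (+ 4))
    where open Cells Δ-rotation n

  Δ-returns-within-3 : ∀ n → ¬ (Ioo 13 24 (Δ n) ⊎ Ioo 51 62 (Δ n)) → ReturnsBelowθ 3 Δ n
  Δ-returns-within-3 n excluded =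
    subdivide (Δ′-window n) (- + 300 + + 140 √5) (pick 3 (+ 5)) λ Δ∈ →
    subdivide Δ∈ (pct′ 24) (λ Δ∈ → ⊥-elim (excluded (inj₁ (Ioo-from 13 Δ∈)))) λ Δ∈ →
    subdivide Δ∈ (- + 150 + + 90 √5) (pick 2 (+ 3)) λ Δ∈ →
    subdivide Δ∈ (pct′ 62) (λ Δ∈ → ⊥-elim (excluded (inj₂ (Ioo-from 51 Δ∈)))) λ Δ∈ →
    subdivide Δ∈ (0ℤ + + 40 √5) (pick 1 (+ 1)) (pick 3 (+ 4))
    where open Cells Δ-rotation n

  Δ-returns-twice-within-6 : ∀ n → ¬ (Ico 0 24 (Δ n) ⊎ Ioo 36 62 (Δ n) ⊎ Ioc 97 100 (Δ n)) → ReturnsTwiceBelowθ 6 Δ n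
  Δ-returns-twice-within-6 n excluded =
    subdivide (Δ′-window n) (pct′ 24) (λ Δ∈ → ⊥-elim (excluded (inj₁ (Ico-from Δ∈)))) λ Δ∈ →
    subdivide Δ∈ (- + 500 + + 240 √5) (pick₂ 2 (+ 3) 5 (+ 8)) λ Δ∈ →
    subdivide Δ∈ (pct′ 62) (λ Δ∈ → ⊥-elim (excluded (inj₂ (inj₁ (Ioo-from 36 Δ∈))))) λ Δ∈ →
    subdivide Δ∈ (- + 350 + + 190 √5) (pick₂ 1 (+ 1) 4 (+ 6)) λ Δ∈ →
    subdivide Δ∈ (0ℤ + + 40 √5) (pick₂ 1 (+ 1) 6 (+ 9)) λ Δ∈ →
    subdivide Δ∈ (- + 550 + + 290 √5) (pick₂ 3 (+ 4) 6 (+ 9)) (λ Δ∈ → ⊥-elim (excluded (inj₂ (inj₂ (Ioc-from 97 Δ∈)))))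
    where open Cells Δ-rotation n

open FractionalParts
  using ( δ-returns-within-5; δ-returns-within-3; δ-returns-twice-within-6
        ; Δ-returns-within-5; Δ-returns-within-3; Δ-returns-twice-within-6 )
open import Data.Nat using (ℕ; _+_; _≤_; _<_)
open import Data.Product using (_×_; _,_; ∃-syntax)
open import Data.Sum using (_⊎_)
open import Relation.Nullary using (¬_)

lemma16 : (n : ℕ) →
    -- (1)
    (∃[ ℓ ] (1 ≤ ℓ × ℓ ≤ 5 × δ (n + ℓ) <₅ θ))
    × (¬ (Ico 0 15 (δ n) ⊎ Ioo 65 77 (δ n)) →
        ∃[ ℓ ] (1 ≤ ℓ × ℓ ≤ 3 × δ (n + ℓ) <₅ θ))
    × (¬ (Ico 0 30 (δ n) ⊎ Ioc 65 100 (δ n)) →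
        ∃[ ℓ ] ∃[ ℓ′ ] (1 ≤ ℓ × ℓ < ℓ′ × ℓ′ ≤ 6 × δ (n + ℓ) <₅ θ × δ (n + ℓ′) <₅ θ))
    -- (2)
    × (∃[ ℓ ] (1 ≤ ℓ × ℓ ≤ 5 × Δ (n + ℓ) <₅ θ))
    × (¬ (Ioo 13 24 (Δ n) ⊎ Ioo 51 62 (Δ n)) →
        ∃[ ℓ ] (1 ≤ ℓ × ℓ ≤ 3 × Δ (n + ℓ) <₅ θ))
    × (¬ (Ico 0 24 (Δ n) ⊎ Ioo 36 62 (Δ n) ⊎ Ioc 97 100 (Δ n)) →
        ∃[ ℓ ] ∃[ ℓ′ ] (1 ≤ ℓ × ℓ < ℓ′ × ℓ′ ≤ 6 × Δ (n + ℓ) <₅ θ × Δ (n + ℓ′) <₅ θ))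
lemma16 n = δ-returns-within-5 n , δ-returns-within-3 n , δ-returns-twice-within-6 n
          , Δ-returns-within-5 n , Δ-returns-within-3 n , Δ-returns-twice-within-6 n
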